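{- Let $\gamma$ be a PDL program, $\mathcal{M}=(W,R,V)$ a Kripke model, and $v,w\in W$ with $(v,w)\in R_\gamma$. Then there is a pair $(X,\bar\delta)\in H_\gamma$ such that $\mathcal{M},v\Vdash X$ (all formulas of $X$ hold at $v$) and $(v,w)\in R_{\bar\delta}$.
   Context: PDL syntax $\phi ::= \bot \mid p \mid \lnot\phi \mid \phi\land\phi \mid [\alpha]\phi$, $\alpha ::= a \mid \tau? \mid \alpha\cup\beta \mid \alpha;\beta \mid \alpha^\ast$ with standard Kripke semantics ($R_{\tau?}$ identity on states satisfying $\tau$, union, composition, reflexive-transitive closure). For a list of programs, $R_\varepsilon$ is the identity and $R_{\alpha\bar\delta}$ is $R_\alpha$ followed by $R_{\bar\delta}$. $H_a=\{(\emptyset,a)\}$; $H_{\tau?}=\{(\{\tau\},\varepsilon)\}$; $H_{\alpha\cup\beta}=H_\alpha\cup H_\beta$; $H_{\alpha;\beta}=\{(X,\bar\delta\beta)\mid(X,\bar\delta)\in H_\alpha,\bar\delta\neq\varepsilon\}\cup\{(X\cup Y,\bar\delta)\mid(X,\varepsilon)\in H_\alpha,(Y,\bar\delta)\in H_\beta\}$; $H_{\alpha^\ast}=\{(\emptyset,\varepsilon)\}\cup\{(X,\bar\delta\alpha^\ast)\mid(X,\bar\delta)\in H_\alpha,\bar\delta\neq\varepsilon\}$ (juxtaposition is concatenation of lists). -}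

module Defs where

open import Data.Nat using (ℕ)
open import Data.List using (List; []; _∷_; _++_; map; concatMap)
open import Data.List.Relation.Unary.All using (All)
open import Data.Product using (Σ; _×_; _,_; ∃)
open import Data.Empty using (⊥)
open import Data.Sum using (_⊎_)
open import Relation.Binary.PropositionalEquality using (_≡_)
open import Relation.Binary.Construct.Closure.ReflexiveTransitive using (Star)

mutual
  data Form : Set where
    ⊥f  : Form
    var : ℕ → Form
    ¬f_ : Form → Form
    _∧f_ : Form → Form → Form
    [_]_ : Prog → Form → Form

  data Prog : Set where
    atom : ℕ → Prog
    _¿   : Form → Prog
    _∪p_ : Prog → Prog → Prog
    _⨾_  : Prog → Prog → Prog
    _✶   : Prog → Prog

record Model : Set₁ where
  field
    W : Set
    R : ℕ → W → W → Set
    V : ℕ → W → Set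

module _ (M : Model) where
  open Model M

  mutual
    Sat : Form → W → Set
    Sat ⊥f w = ⊥
    Sat (var p) w = V p w
    Sat (¬f φ) w = Sat φ w → ⊥
    Sat (φ ∧f ψ) w = Sat φ w × Sat ψ w
    Sat ([ α ] φ) w = ∀ u → Rel α w u → Sat φ u

    Rel : Prog → W → W → Set
    Rel (atom a) v w = R a v w
    Rel (τ ¿) v w = (v ≡ w) × Sat τ v
    Rel (α ∪p β) v w = Rel α v w ⊎ Rel β v w
    Rel (α ⨾ β) v w = ∃ λ u → Rel α v u × Rel β u w
    Rel (α ✶) v w = Star (Rel α) v w

  RelL : List Prog → W → W → Set
  RelL [] v w = v ≡ w
  RelL (α ∷ δs) v w = ∃ λ u → Rel α v u × RelL δs u w

  SatAll : List Form → W → Set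
  SatAll X v = All (λ φ → Sat φ v) X


-- H_γ as a (finite) list of pairs (X , δ̄); the set X is represented by a list.
H : Prog → List (List Form × List Prog)
H (atom a) = ([] , atom a ∷ []) ∷ []
H (τ ¿) = ((τ ∷ []) , []) ∷ []
H (α ∪p β) = H α ++ H β
H (α ⨾ β) = concatMap left (H α)
  where
    left : List Form × List Prog → List (List Form × List Prog)
    left (X , []) = map (λ { (Y , δs) → (X ++ Y , δs) }) (H β)
    left (X , (d ∷ ds)) = (X , (d ∷ ds) ++ (β ∷ [])) ∷ []
H (α ✶) = ([] , []) ∷ concatMap step (H α)
  where
    step : List Form × List Prog → List (List Form × List Prog)
    step (X , []) = []
    step (X , (d ∷ ds)) = (X , (d ∷ ds) ++ (α ✶ ∷ [])) ∷ []

{-# OPTIONS --safe #-}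
-- For α ; β and α*, apply the induction hypothesis to the first α-step
-- v → u: a witness (X , δ̄) with δ̄ nonempty is extended by appending the rest of the
-- program (β, resp. α*) to δ̄; a witness with δ̄ = ε forces u = v, so the rest of the run
-- already starts at v and supplies the witness (for α*, by recursion along the run).
module Submission where

open import Defs
open import Data.List using (List; []; _∷_; _++_)
open import Data.List.Membership.Propositional using (_∈_; lose)
open import Data.List.Membership.Propositional.Properties
  using (∈-++⁺ˡ; ∈-++⁺ʳ; ∈-map⁺; ∈-concatMap⁺)
open import Data.List.Relation.Unary.All using ([]; _∷_)
open import Data.List.Relation.Unary.All.Properties using (++⁺)
open import Data.List.Relation.Unary.Any using (here; there)
open import Data.Product using (Σ; _×_; _,_)
open import Data.Sum using (inj₁; inj₂)
open import Relation.Binary.PropositionalEquality using (refl)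
open import Relation.Binary.Construct.Closure.ReflexiveTransitive using (Star; ε; _◅_)

module _ {M : Model} where
  open Model M using (W)

  RelL-++ : ∀ δs {εs u v w} → RelL M δs u v → RelL M εs v w → RelL M (δs ++ εs) u w
  RelL-++ []       refl         r′ = r′
  RelL-++ (δ ∷ δs) (x , r , rs) r′ = x , r , RelL-++ δs rs r′

  RelL-∷ʳ : ∀ δs {β u v w} → RelL M δs u v → Rel M β v w → RelL M (δs ++ β ∷ []) u w
  RelL-∷ʳ δs {w = w} rs r = RelL-++ δs rs (w , r , refl)

  HWitness : Prog → W → W → Set
  HWitness γ v w = Σ (List Form × List Prog) λ { (X , δs) →
    ((X , δs) ∈ H γ) × SatAll M X v × RelL M δs v w }

  HWitness-∪ˡ : ∀ α β {v w} → HWitness α v w → HWitness (α ∪p β) v w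
  HWitness-∪ˡ α β (p , p∈H , sat , rs) = p , ∈-++⁺ˡ p∈H , sat , rs

  HWitness-∪ʳ : ∀ α β {v w} → HWitness β v w → HWitness (α ∪p β) v w
  HWitness-∪ʳ α β (p , p∈H , sat , rs) = p , ∈-++⁺ʳ (H α) p∈H , sat , rs

  HWitness-⨾ : ∀ α β {v u w} → HWitness α v u → Rel M β u w → HWitness β u w →
               HWitness (α ⨾ β) v w
  HWitness-⨾ α β ((X , δ ∷ δs) , p∈H , satX , rs) r _ =
    (X , (δ ∷ δs) ++ β ∷ []) , ∈-concatMap⁺ _ (lose p∈H (here refl)) , satX ,
    RelL-∷ʳ (δ ∷ δs) rs r
  HWitness-⨾ α β ((X , []) , p∈H , satX , refl) _ ((Y , δs) , q∈H , satY , rs) =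
    (X ++ Y , δs) , ∈-concatMap⁺ _ (lose p∈H (∈-map⁺ _ q∈H)) , ++⁺ satX satY , rs

  HWitness-✶ : ∀ α → (∀ {v w} → Rel M α v w → HWitness α v w) →
               ∀ {v w} → Star (Rel M α) v w → HWitness (α ✶) v w
  HWitness-✶ α witness ε = ([] , []) , here refl , [] , refl
  HWitness-✶ α witness (r ◅ rs) with witness r
  ... | (X , []) , _ , _ , refl = HWitness-✶ α witness rs
  ... | (X , δ ∷ δs) , p∈H , satX , rs′ =
    (X , (δ ∷ δs) ++ α ✶ ∷ []) , there (∈-concatMap⁺ _ (lose p∈H (here refl))) , satX ,
    RelL-∷ʳ (δ ∷ δs) rs′ rs

lemma3p26 : (γ : Prog) (M : Model) (v w : Model.W M) →
    Rel M γ v w →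
    Σ (List Form × List Prog) λ { (X , δs) →
      ((X , δs) ∈ H γ) × SatAll M X v × RelL M δs v w }
lemma3p26 (atom a)  M v w r              = _ , here refl , [] , (w , r , refl)
lemma3p26 (τ ¿)     M v w (refl , sat)   = _ , here refl , sat ∷ [] , refl
lemma3p26 (α ∪p β)  M v w (inj₁ r)       = HWitness-∪ˡ α β (lemma3p26 α M v w r)
lemma3p26 (α ∪p β)  M v w (inj₂ r)       = HWitness-∪ʳ α β (lemma3p26 β M v w r)
lemma3p26 (α ⨾ β)   M v w (u , r , r′)   =
  HWitness-⨾ α β (lemma3p26 α M v u r) r′ (lemma3p26 β M u w r′)
lemma3p26 (α ✶)     M v w rs             = HWitness-✶ α (lemma3p26 α M _ _) rs
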